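{- Let $\Delta$ be a simplex and let $F \in \Delta$ be a nonempty face. Then the stellar subdivision of $\Delta$ at $F$ is sesquiconstructible.
   Context: A simplex is the complex of all subsets of a finite set. The stellar subdivision of a complex $\Gamma$ at a nonempty face $F$ is obtained by introducing a new vertex $p$, deleting all faces containing $F$, and adding all faces $\{p\}\cup H$ where $H\in\Gamma$, $F\not\subseteq H$ and $H\cup F\in\Gamma$. A pure complex has all facets (maximal faces) of the same dimension; ridges are faces of dimension one less than the facets. For a pure complex $\Gamma$, $\partial\Gamma$ is the subcomplex of all faces contained in some ridge lying in exactly one facet ($\partial\Gamma=\emptyset$ if none). A pure complex $\Gamma$ of dimension $n-1$ is sesquiconstructible if either $\Gamma$ is a simplex, or $\Gamma = U\cup V$ where (1) $U$ and $V$ are sesquiconstructible complexes of dimension $n-1$, (2) $U\cap V$ is a sesquiconstructible complex of dimension $n-2$, and (3) either $\partial(U\cap V)=\emptyset$ or $\partial(U\cap V)$ is a sesquiconstructible complex of dimension $n-3$. -}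

module Defs where

open import Data.Nat using (ℕ; zero; suc; _+_)
open import Data.Fin using (Fin)
open import Data.Fin.Subset using (Subset; _⊆_; _∪_; ∣_∣)
open import Data.Vec using (_∷_)
open import Data.Bool using (true; false)
open import Data.Product using (Σ; ∃; _×_)
open import Data.Sum using (_⊎_)
open import Relation.Nullary using (¬_)
open import Relation.Binary.PropositionalEquality using (_≡_)
open import Function.Bundles using (_⇔_)

-- A (simplicial) complex on the vertex set Fin n is given by the predicate
-- "σ is a face".  Faces are subsets of Fin n.
Cx : ℕ → Set₁
Cx n = Subset n → Set

_≐_ : ∀ {n} → Cx n → Cx n → Set
Γ ≐ Δ = ∀ σ → Γ σ ⇔ Δ σ

_∪ᶜ_ : ∀ {n} → Cx n → Cx n → Cx n
(U ∪ᶜ V) σ = U σ ⊎ V σ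

_∩ᶜ_ : ∀ {n} → Cx n → Cx n → Cx n
(U ∩ᶜ V) σ = U σ × V σ

Simplex : ∀ {n} → Subset n → Cx n
Simplex S σ = σ ⊆ S

IsVoid : ∀ {n} → Cx n → Set
IsVoid Γ = ∀ σ → ¬ Γ σ

Facet : ∀ {n} → Cx n → Subset n → Set
Facet Γ σ = Γ σ × (∀ τ → Γ τ → σ ⊆ τ → τ ≡ σ)

-- For a pure complex Γ whose facets have k vertices (dimension k-1):
-- a ridge is a face with k-1 vertices (dimension k-2).
Ridge : ∀ {n} → ℕ → Cx n → Subset n → Set
Ridge k Γ ρ = Γ ρ × (∣ ρ ∣ + 1 ≡ k)

InExactlyOneFacet : ∀ {n} → Cx n → Subset n → Set
InExactlyOneFacet Γ ρ =
  Σ (Subset _) λ G → Facet Γ G × ρ ⊆ G ×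
    (∀ G′ → Facet Γ G′ → ρ ⊆ G′ → G′ ≡ G)

∂ : ∀ {n} → ℕ → Cx n → Cx n
∂ k Γ σ = Σ (Subset _) λ ρ → Ridge k Γ ρ × InExactlyOneFacet Γ ρ × σ ⊆ ρ

-- Sesquiconstructible complexes, indexed by the number k of vertices of the
-- facets (so dimension k - 1).  Dimensions n-1, n-2, n-3 become k, k-1, k-2.
data SC {n : ℕ} : ℕ → Cx n → Set₁ where
  simplex : ∀ {Γ} (S : Subset n) → Γ ≐ Simplex S → SC ∣ S ∣ Γ
  glue-nobd : ∀ {k Γ} (U V : Cx n) → Γ ≐ (U ∪ᶜ V) →
    SC (suc k) U → SC (suc k) V → SC k (U ∩ᶜ V) →
    IsVoid (∂ k (U ∩ᶜ V)) → SC (suc k) Γ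
  glue-bd : ∀ {j Γ} (U V : Cx n) → Γ ≐ (U ∪ᶜ V) →
    SC (suc (suc j)) U → SC (suc (suc j)) V → SC (suc j) (U ∩ᶜ V) →
    SC j (∂ (suc j) (U ∩ᶜ V)) → SC (suc (suc j)) Γ

-- stellar subdivision of Γ (on Fin n) at the face F; the new vertex p is
-- the vertex zero of Fin (suc n), the old vertices are shifted by one.
Stellar : ∀ {n} → Cx n → Subset n → Cx (suc n)
Stellar Γ F (false ∷ H) = Γ H × ¬ (F ⊆ H)
Stellar Γ F (true ∷ H) = Γ H × ¬ (F ⊆ H) × Γ (H ∪ F)

-- The stellar subdivision of the simplex on S at F is the simplex on S ∪ {p}
-- with the faces containing F removed.  More generally, for nonempty pairwise
-- disjoint G₁, …, Gᵣ ⊆ W (or just Admissible W Gs) the complex Avoiding W Gs of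
-- subsets of W containing no Gᵢ is sesquiconstructible.  For v ∈ G₁ it is the
-- union of Avoiding (W - v) Gs and Avoiding W (G₁ - v ∷ Gs), which meet in
-- Avoiding (W - v) (G₁ - v ∷ Gs), one dimension lower.  The boundary of that
-- intersection is again of this form, Avoiding (W - v) (F′ ∷ G₁ - v ∷ Gs) with
-- F′ the vertices lying in no Gᵢ, because a ridge lies in a unique facet exactly
-- when the vertex it misses is in F′.  Induct on the dimension, then on Σ ∣Gᵢ∣.
module Submission where

open import Defs
open import Data.Nat using (ℕ; zero; suc; _+_; _≤_)
open import Data.Nat.Properties
  using (+-suc; +-assoc; +-comm; +-identityʳ; +-cancelʳ-≡; suc-injective; ≤-refl; ≤-pred; ≤-reflexive;
         m≤n+m; m+n≤o⇒m≤o; m+n≤o⇒n≤o; <-≤-trans; <⇒≱; n≮0; 1+n≰n)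
open import Data.Fin using (Fin; zero; suc) renaming (_≟_ to _≟ᶠ_)
open import Data.Fin.Subset
  using (Subset; _∈_; _∉_; _⊆_; _⊈_; _─_; _-_; _∪_; ⁅_⁆; ⋃; Nonempty; Empty; ∣_∣; inside; outside)
  renaming (⊥ to ∅)
open import Data.Fin.Subset.Properties
  using (⊆-refl; ⊆-trans; ⊆-antisym; ⊆-reflexive; _⊆?_; _∈?_; nonempty?; ∉⊥; ⊆-min; x∈⁅x⁆;
         x∈p∪q⁻; x∈p∪q⁺; p─q⊆p; x∈p∧x∉q⇒x∈p─q; x∈p∧x≢y⇒x∈p-y; p─x─y≡p─y─x; p─⊥≡p;
         x∈p⇒∣p-x∣<∣p∣; p⊆q⇒∣p∣≤∣q∣; p⊂q⇒∣p∣<∣q∣; drop-there; drop-∷-⊆; out⊆; in⊆in; s⊆s)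
open import Data.Vec using ([]; _∷_; here; there)
open import Data.List using (List; []; _∷_; length)
open import Data.List.Relation.Unary.All using (All; []; _∷_) renaming (map to mapAll)
open import Data.Product using (∃-syntax; _×_; _,_; proj₁; proj₂)
open import Data.Sum using (_⊎_; inj₁; inj₂)
open import Data.Empty using (⊥; ⊥-elim)
open import Data.Unit using (⊤; tt)
open import Level using (Lift; lift)
open import Relation.Nullary using (yes; no)
open import Relation.Binary.PropositionalEquality using (_≡_; _≢_; refl; sym; trans; cong; subst; module ≡-Reasoning)
open import Relation.Binary.Structures using (IsEquivalence)
open import Function.Base using (_∘_)
open import Function.Bundles using (mk⇔; Equivalence)
open import Function.Properties.Equivalence using (⇔-isEquivalence)
open Equivalence using (to; from)

private
  variable
    n m k : ℕ
    x y : Fin n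
    p q σ ρ T W G : Subset n
    Gs : List (Subset n)
    Γ Δ U V I : Cx n

  module ⇔ = IsEquivalence (⇔-isEquivalence {ℓ = Level.zero})

≐-sym : Γ ≐ Δ → Δ ≐ Γ
≐-sym e σ = ⇔.sym (e σ)

≐-trans : Γ ≐ Δ → Δ ≐ U → Γ ≐ U
≐-trans e e′ σ = ⇔.trans (e σ) (e′ σ)

∪ᶜ-voidʳ : IsVoid V → (U ∪ᶜ V) ≐ U
∪ᶜ-voidʳ void σ = mk⇔ (λ { (inj₁ u) → u ; (inj₂ v) → ⊥-elim (void σ v) }) inj₁

Facet-resp : Γ ≐ Δ → Facet Γ σ → Facet Δ σ
Facet-resp e (σ-face , σ-max) = to (e _) σ-face , λ τ τ-face σ⊆τ → σ-max τ (from (e τ) τ-face) σ⊆τ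

∂-resp⁺ : Γ ≐ Δ → ∂ k Γ σ → ∂ k Δ σ
∂-resp⁺ e (ρ , (ρ-face , ∣ρ∣+1≡k) , (G , G-facet , ρ⊆G , unique) , σ⊆ρ) =
  ρ , (to (e ρ) ρ-face , ∣ρ∣+1≡k) ,
  (G , Facet-resp e G-facet , ρ⊆G , λ G′ G′-facet → unique G′ (Facet-resp (≐-sym e) G′-facet)) , σ⊆ρ

∂-resp : Γ ≐ Δ → ∂ k Γ ≐ ∂ k Δ
∂-resp e σ = mk⇔ (∂-resp⁺ e) (∂-resp⁺ (≐-sym e))

SC-resp : Γ ≐ Δ → SC k Γ → SC k Δ
SC-resp e (simplex S e′) = simplex S (≐-trans (≐-sym e) e′)
SC-resp e (glue-nobd U V e′ u v i ∂-void) = glue-nobd U V (≐-trans (≐-sym e) e′) u v i ∂-void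
SC-resp e (glue-bd U V e′ u v i ∂-sc) = glue-bd U V (≐-trans (≐-sym e) e′) u v i ∂-sc

SC-of-∂ : ℕ → Cx n → Set₁
SC-of-∂ zero _ = Lift _ ⊥
SC-of-∂ (suc j) I = SC j (∂ (suc j) I)

BoundaryCondition : ℕ → Cx n → Set₁
BoundaryCondition k I = IsVoid (∂ k I) ⊎ SC-of-∂ k I

glue : Γ ≐ (U ∪ᶜ V) → I ≐ (U ∩ᶜ V) →
       SC (suc k) U → SC (suc k) V → SC k I → BoundaryCondition k I → SC (suc k) Γ
glue e e′ u v i (inj₁ ∂-void) = glue-nobd _ _ e u v (SC-resp e′ i) λ σ → ∂-void σ ∘ from (∂-resp e′ σ)
glue {k = zero} _ _ _ _ _ (inj₂ (lift ()))
glue {k = suc j} e e′ u v i (inj₂ ∂-sc) = glue-bd _ _ e u v (SC-resp e′ i) (SC-resp (∂-resp e′) ∂-sc)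

x∈p─q⁻ : ∀ (p q : Subset n) → x ∈ p ─ q → x ∈ p × x ∉ q
x∈p─q⁻ (inside ∷ p) (outside ∷ q) here = here , λ ()
x∈p─q⁻ {x = zero} (outside ∷ p) (outside ∷ q) ()
x∈p─q⁻ {x = zero} (outside ∷ p) (inside ∷ q) ()
x∈p─q⁻ {x = zero} (inside ∷ p) (inside ∷ q) ()
x∈p─q⁻ (_ ∷ p) (_ ∷ q) (there x∈p─q) with x∈p─q⁻ p q x∈p─q
... | x∈p , x∉q = there x∈p , λ x∈q → x∉q (drop-there x∈q)

x∉p-x : ∀ (p : Subset n) → x ∉ p - x
x∉p-x {x = x} p x∈p-x = proj₂ (x∈p─q⁻ p ⁅ x ⁆ x∈p-x) (x∈⁅x⁆ x)

p⊆q∧x∉p⇒p⊆q-x : p ⊆ q → x ∉ p → p ⊆ q - x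
p⊆q∧x∉p⇒p⊆q-x p⊆q x∉p y∈p = x∈p∧x≢y⇒x∈p-y (p⊆q y∈p) λ { refl → x∉p y∈p }

p-x⊆q∧x∈q⇒p⊆q : p - x ⊆ q → x ∈ q → p ⊆ q
p-x⊆q∧x∈q⇒p⊆q {x = x} p-x⊆q x∈q {y} y∈p with y ≟ᶠ x
... | yes refl = x∈q
... | no y≢x = p-x⊆q (x∈p∧x≢y⇒x∈p-y y∈p y≢x)

p⊈q⇒∃ : ∀ (p q : Subset n) → p ⊈ q → ∃[ x ] x ∈ p × x ∉ q
p⊈q⇒∃ [] [] p⊈q = ⊥-elim (p⊈q λ ())
p⊈q⇒∃ (s ∷ p) (t ∷ q) p⊈q with p ⊆? q
... | no p⊈q′ with p⊈q⇒∃ p q p⊈q′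
...   | x , x∈p , x∉q = suc x , there x∈p , λ x∈q → x∉q (drop-there x∈q)
p⊈q⇒∃ (inside ∷ p) (outside ∷ q) p⊈q | yes _ = zero , here , λ ()
p⊈q⇒∃ (inside ∷ p) (inside ∷ q) p⊈q | yes p⊆q = ⊥-elim (p⊈q (in⊆in p⊆q))
p⊈q⇒∃ (outside ∷ p) (t ∷ q) p⊈q | yes p⊆q = ⊥-elim (p⊈q (out⊆ p⊆q))

∣p-x∣+1≡∣p∣ : ∀ (p : Subset n) → x ∈ p → suc ∣ p - x ∣ ≡ ∣ p ∣
∣p-x∣+1≡∣p∣ (inside ∷ p) here = cong (λ r → suc ∣ r ∣) (p─⊥≡p p)
∣p-x∣+1≡∣p∣ (inside ∷ p) (there x∈p) = cong suc (∣p-x∣+1≡∣p∣ p x∈p)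
∣p-x∣+1≡∣p∣ (outside ∷ p) (there x∈p) = ∣p-x∣+1≡∣p∣ p x∈p

p⊆q∧∣p∣≡∣q∣⇒p≡q : p ⊆ q → ∣ p ∣ ≡ ∣ q ∣ → p ≡ q
p⊆q∧∣p∣≡∣q∣⇒p≡q {p = p} {q} p⊆q ∣p∣≡∣q∣ with q ⊆? p
... | yes q⊆p = ⊆-antisym p⊆q q⊆p
... | no q⊈p = ⊥-elim (<⇒≱ (p⊂q⇒∣p∣<∣q∣ (p⊆q , p⊈q⇒∃ q p q⊈p)) (≤-reflexive (sym ∣p∣≡∣q∣)))

∪-least : p ⊆ σ → q ⊆ σ → p ∪ q ⊆ σ
∪-least {p = p} {q = q} p⊆σ q⊆σ x∈p∪q with x∈p∪q⁻ p q x∈p∪q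
... | inj₁ x∈p = p⊆σ x∈p
... | inj₂ x∈q = q⊆σ x∈q

1+k≡∣p∣⇒k≡∣p-x∣ : x ∈ p → suc k ≡ ∣ p ∣ → k ≡ ∣ p - x ∣
1+k≡∣p∣⇒k≡∣p-x∣ {p = p} x∈p 1+k≡ = suc-injective (trans 1+k≡ (sym (∣p-x∣+1≡∣p∣ p x∈p)))

∣p∣+m≤1+k⇒∣p-x∣+m≤k : x ∈ p → ∣ p ∣ + m ≤ suc k → ∣ p - x ∣ + m ≤ k
∣p∣+m≤1+k⇒∣p-x∣+m≤k {x = x} {p = p} {m = m} x∈p ≤1+k =
  ≤-pred (subst (λ c → c + m ≤ _) (sym (∣p-x∣+1≡∣p∣ p x∈p)) ≤1+k)

∣p∣+m≤1+k⇒m≤k : x ∈ p → ∣ p ∣ + m ≤ suc k → m ≤ k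
∣p∣+m≤1+k⇒m≤k {x = x} {p = p} x∈p ≤1+k = m+n≤o⇒n≤o ∣ p - x ∣ (∣p∣+m≤1+k⇒∣p-x∣+m≤k x∈p ≤1+k)

Avoiding : Subset n → List (Subset n) → Cx n
Avoiding W Gs σ = σ ⊆ W × All (_⊈ σ) Gs

Avoiding-↓ : Avoiding W Gs ρ → σ ⊆ ρ → Avoiding W Gs σ
Avoiding-↓ (ρ⊆W , Gs⊈ρ) σ⊆ρ = ⊆-trans σ⊆ρ ρ⊆W , mapAll (λ G⊈ρ → ⊈-⊆-trans G⊈ρ σ⊆ρ) Gs⊈ρ
  where
  ⊈-⊆-trans : G ⊈ ρ → σ ⊆ ρ → G ⊈ σ
  ⊈-⊆-trans G⊈ρ σ⊆ρ G⊆σ = G⊈ρ (⊆-trans G⊆σ σ⊆ρ)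

Avoiding-mono : W ⊆ p → Avoiding W Gs σ → Avoiding p Gs σ
Avoiding-mono W⊆p (σ⊆W , Gs⊈σ) = ⊆-trans σ⊆W W⊆p , Gs⊈σ

Avoiding-[] : Avoiding W [] ≐ Simplex W
Avoiding-[] σ = mk⇔ proj₁ (_, [])

Avoiding-void : Empty G → IsVoid (Avoiding W (G ∷ Gs))
Avoiding-void G-empty σ (_ , G⊈σ ∷ _) = G⊈σ λ x∈G → ⊥-elim (G-empty (_ , x∈G))

Avoiding-split : x ∈ G → Avoiding W (G ∷ Gs) ≐ (Avoiding (W - x) Gs ∪ᶜ Avoiding W ((G - x) ∷ Gs))
Avoiding-split {x = x} {G = G} {W = W} x∈G σ = mk⇔ split join
  where
  split : Avoiding W (G ∷ Gs) σ → (Avoiding (W - x) Gs ∪ᶜ Avoiding W ((G - x) ∷ Gs)) σ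
  split (σ⊆W , G⊈σ ∷ Gs⊈σ) with x ∈? σ
  ... | no x∉σ = inj₁ (p⊆q∧x∉p⇒p⊆q-x σ⊆W x∉σ , Gs⊈σ)
  ... | yes x∈σ = inj₂ (σ⊆W , (λ G-x⊆σ → G⊈σ (p-x⊆q∧x∈q⇒p⊆q G-x⊆σ x∈σ)) ∷ Gs⊈σ)
  join : (Avoiding (W - x) Gs ∪ᶜ Avoiding W ((G - x) ∷ Gs)) σ → Avoiding W (G ∷ Gs) σ
  join (inj₁ (σ⊆W-x , Gs⊈σ)) = ⊆-trans σ⊆W-x (p─q⊆p W ⁅ x ⁆) , (λ G⊆σ → x∉p-x W (σ⊆W-x (G⊆σ x∈G))) ∷ Gs⊈σ
  join (inj₂ (σ⊆W , G-x⊈σ ∷ Gs⊈σ)) = σ⊆W , (λ (G⊆σ : G ⊆ σ) → G-x⊈σ (⊆-trans (p─q⊆p G ⁅ x ⁆) G⊆σ)) ∷ Gs⊈σ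

Avoiding-meet : Avoiding (W - x) ((G - x) ∷ Gs) ≐ (Avoiding (W - x) Gs ∩ᶜ Avoiding W ((G - x) ∷ Gs))
Avoiding-meet {W = W} {x = x} σ =
  mk⇔ (λ { (σ⊆W-x , G-x⊈σ ∷ Gs⊈σ) → (σ⊆W-x , Gs⊈σ) , (⊆-trans σ⊆W-x (p─q⊆p W ⁅ x ⁆) , G-x⊈σ ∷ Gs⊈σ) })
      (λ { ((σ⊆W-x , Gs⊈σ) , (_ , G-x⊈σ ∷ _)) → σ⊆W-x , G-x⊈σ ∷ Gs⊈σ })

-- Holds when the Gᵢ are nonempty, pairwise disjoint subsets of W, i.e. for the
-- joins Δ(W ∖ ⋃ Gs) * ∂G₁ * … * ∂Gᵣ.
Admissible : Subset n → List (Subset n) → Set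
Admissible W [] = ⊤
Admissible W (G ∷ Gs) = Nonempty G × G ⊆ W × (∀ {x} → x ∈ G → Admissible (W - x) Gs)

weight : List (Subset n) → ℕ
weight [] = 0
weight (G ∷ Gs) = ∣ G ∣ + weight Gs

⋃⊆ : Admissible W Gs → ⋃ Gs ⊆ W
⋃⊆ {Gs = []} _ = ⊆-min _
⋃⊆ {W = W} {Gs = G ∷ Gs} ((x , x∈G) , G⊆W , adm) y∈⋃ with x∈p∪q⁻ G (⋃ Gs) y∈⋃
... | inj₁ y∈G = G⊆W y∈G
... | inj₂ y∈⋃Gs = p─q⊆p W ⁅ x ⁆ (⋃⊆ (adm x∈G) y∈⋃Gs)

admissible-del : Admissible W Gs → y ∉ ⋃ Gs → Admissible (W - y) Gs
admissible-del {Gs = []} _ _ = tt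
admissible-del {W = W} {Gs = G ∷ Gs} {y = y} (G≢∅ , G⊆W , adm) y∉⋃ =
  G≢∅ ,
  (λ x∈G → x∈p∧x≢y⇒x∈p-y (G⊆W x∈G) λ { refl → y∉⋃ (x∈p∪q⁺ (inj₁ x∈G)) }) ,
  λ {x} x∈G → subst (λ W′ → Admissible W′ Gs) (p─x─y≡p─y─x W x y)
                (admissible-del (adm x∈G) λ y∈⋃Gs → y∉⋃ (x∈p∪q⁺ {p = G} (inj₂ y∈⋃Gs)))

admissible-shrink : Admissible W (G ∷ Gs) → x ∈ G → Nonempty (G - x) → Admissible W ((G - x) ∷ Gs)
admissible-shrink {G = G} {x = x} (_ , G⊆W , adm) _ G-x≢∅ =
  G-x≢∅ , (λ y∈G-x → G⊆W (p─q⊆p G ⁅ x ⁆ y∈G-x)) , λ y∈G-x → adm (p─q⊆p G ⁅ x ⁆ y∈G-x)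

admissible-meet : Admissible W (G ∷ Gs) → x ∈ G → Nonempty (G - x) → Admissible (W - x) ((G - x) ∷ Gs)
admissible-meet {W = W} {G = G} {Gs = Gs} {x = x} (_ , G⊆W , adm) x∈G G-x≢∅ =
  G-x≢∅ ,
  (λ y∈G-x → let y∈G , y∉⁅x⁆ = x∈p─q⁻ G ⁅ x ⁆ y∈G-x in
             x∈p∧x≢y⇒x∈p-y (G⊆W y∈G) λ { refl → y∉⁅x⁆ (x∈⁅x⁆ x) }) ,
  λ {y} y∈G-x → subst (λ W′ → Admissible W′ Gs) (p─x─y≡p─y─x W y x)
                  (admissible-del (adm (p─q⊆p G ⁅ x ⁆ y∈G-x)) x∉⋃Gs)
  where
  x∉⋃Gs : x ∉ ⋃ Gs
  x∉⋃Gs x∈⋃Gs = x∉p-x W (⋃⊆ (adm x∈G) x∈⋃Gs)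

admissible-free : Admissible W Gs → Nonempty (W ─ ⋃ Gs) → Admissible W ((W ─ ⋃ Gs) ∷ Gs)
admissible-free {W = W} {Gs = Gs} adm free≢∅ =
  free≢∅ , p─q⊆p W (⋃ Gs) , λ x∈free → admissible-del adm (proj₂ (x∈p─q⁻ W (⋃ Gs) x∈free))

Pruning : Subset n → List (Subset n) → Subset n → Set
Pruning W [] T = T ≡ W
Pruning W (G ∷ Gs) T = ∃[ x ] x ∈ G × Pruning (W - x) Gs T

pruning⇒avoiding : Pruning W Gs T → Avoiding W Gs T
pruning⇒avoiding {Gs = []} refl = ⊆-refl , []
pruning⇒avoiding {W = W} {Gs = G ∷ Gs} (x , x∈G , T-pr) with pruning⇒avoiding T-pr
... | T⊆W-x , Gs⊈T = ⊆-trans T⊆W-x (p─q⊆p W ⁅ x ⁆) , (λ G⊆T → x∉p-x W (T⊆W-x (G⊆T x∈G))) ∷ Gs⊈T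

∣pruning∣ : Admissible W Gs → Pruning W Gs T → ∣ T ∣ + length Gs ≡ ∣ W ∣
∣pruning∣ {Gs = []} _ refl = +-identityʳ _
∣pruning∣ {W = W} {Gs = G ∷ Gs} {T = T} (_ , G⊆W , adm) (x , x∈G , T-pr) = begin
  ∣ T ∣ + suc (length Gs)  ≡⟨ +-suc ∣ T ∣ (length Gs) ⟩
  suc (∣ T ∣ + length Gs)  ≡⟨ cong suc (∣pruning∣ (adm x∈G) T-pr) ⟩
  suc ∣ W - x ∣            ≡⟨ ∣p-x∣+1≡∣p∣ W (G⊆W x∈G) ⟩
  ∣ W ∣                    ∎
  where open ≡-Reasoning

pruning-keeps : Pruning W Gs T → y ∈ W → y ∉ ⋃ Gs → y ∈ T
pruning-keeps {Gs = []} refl y∈W _ = y∈W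
pruning-keeps {Gs = G ∷ Gs} (x , x∈G , T-pr) y∈W y∉⋃ =
  pruning-keeps T-pr (x∈p∧x≢y⇒x∈p-y y∈W λ { refl → y∉⋃ (x∈p∪q⁺ (inj₁ x∈G)) })
                     (λ y∈⋃Gs → y∉⋃ (x∈p∪q⁺ {p = G} (inj₂ y∈⋃Gs)))

avoiding⇒⊆pruning : Admissible W Gs → Avoiding W Gs σ → ∃[ T ] Pruning W Gs T × σ ⊆ T
avoiding⇒⊆pruning {W = W} {Gs = []} _ (σ⊆W , []) = W , refl , σ⊆W
avoiding⇒⊆pruning {Gs = G ∷ Gs} {σ = σ} (_ , _ , adm) (σ⊆W , G⊈σ ∷ Gs⊈σ) with p⊈q⇒∃ G σ G⊈σ
... | x , x∈G , x∉σ with avoiding⇒⊆pruning (adm x∈G) (p⊆q∧x∉p⇒p⊆q-x σ⊆W x∉σ , Gs⊈σ)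
...   | T , T-pr , σ⊆T = T , (x , x∈G , T-pr) , σ⊆T

avoiding⇒⊆pruning-∌ : Admissible W Gs → Avoiding W Gs σ → y ∉ σ → y ∈ ⋃ Gs →
                      ∃[ T ] Pruning W Gs T × σ ⊆ T × y ∉ T
avoiding⇒⊆pruning-∌ {Gs = []} _ _ _ y∈∅ = ⊥-elim (∉⊥ y∈∅)
avoiding⇒⊆pruning-∌ {W = W} {Gs = G ∷ Gs} {σ = σ} {y = y} (_ , _ , adm) (σ⊆W , G⊈σ ∷ Gs⊈σ) y∉σ y∈⋃
  with x∈p∪q⁻ G (⋃ Gs) y∈⋃
... | inj₁ y∈G with avoiding⇒⊆pruning (adm y∈G) (p⊆q∧x∉p⇒p⊆q-x σ⊆W y∉σ , Gs⊈σ)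
...   | T , T-pr , σ⊆T = T , (y , y∈G , T-pr) , σ⊆T , λ y∈T → x∉p-x W (proj₁ (pruning⇒avoiding T-pr) y∈T)
avoiding⇒⊆pruning-∌ {W = W} {Gs = G ∷ Gs} {σ = σ} (_ , _ , adm) (σ⊆W , G⊈σ ∷ Gs⊈σ) y∉σ y∈⋃
    | inj₂ y∈⋃Gs with p⊈q⇒∃ G σ G⊈σ
... | x , x∈G , x∉σ with avoiding⇒⊆pruning-∌ (adm x∈G) (p⊆q∧x∉p⇒p⊆q-x σ⊆W x∉σ , Gs⊈σ) y∉σ y∈⋃Gs
...   | T , T-pr , σ⊆T , y∉T = T , (x , x∈G , T-pr) , σ⊆T , y∉T

-- Any pruning of W through ρ deletes from each Gᵢ the same vertex as ρ does.
pruning-unique : Admissible W Gs → x ∈ W → x ∉ ⋃ Gs → Pruning (W - x) Gs ρ →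
                 ∀ {T₁ T₂} → Pruning W Gs T₁ → Pruning W Gs T₂ → ρ ⊆ T₁ → ρ ⊆ T₂ → T₁ ≡ T₂
pruning-unique {Gs = []} _ _ _ _ T₁≡W T₂≡W _ _ = trans T₁≡W (sym T₂≡W)
pruning-unique {W = W} {Gs = G ∷ Gs} {x = f} {ρ = ρ} (_ , G⊆W , adm) f∈W f∉⋃ (x , x∈G , ρ-pr)
               (x₁ , x₁∈G , T₁-pr) (x₂ , x₂∈G , T₂-pr) ρ⊆T₁ ρ⊆T₂
  with same-step x₁∈G T₁-pr ρ⊆T₁ | same-step x₂∈G T₂-pr ρ⊆T₂
  where
  same-step : ∀ {z T} → z ∈ G → Pruning (W - z) Gs T → ρ ⊆ T → z ≡ x
  same-step {z} z∈G T-pr ρ⊆T with z ≟ᶠ x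
  ... | yes z≡x = z≡x
  ... | no z≢x = ⊥-elim (x∉p-x W (proj₁ (pruning⇒avoiding T-pr) (ρ⊆T z∈ρ)))
    where
    z∈ρ : z ∈ ρ
    z∈ρ = pruning-keeps ρ-pr
            (x∈p∧x≢y⇒x∈p-y (x∈p∧x≢y⇒x∈p-y (G⊆W z∈G) λ { refl → f∉⋃ (x∈p∪q⁺ (inj₁ z∈G)) }) z≢x)
            (λ z∈⋃Gs → x∉p-x W (⋃⊆ (adm z∈G) z∈⋃Gs))
... | refl | refl =
  pruning-unique (adm x∈G)
    (x∈p∧x≢y⇒x∈p-y f∈W λ { refl → f∉⋃ (x∈p∪q⁺ (inj₁ x∈G)) })
    (λ f∈⋃Gs → f∉⋃ (x∈p∪q⁺ {p = G} (inj₂ f∈⋃Gs)))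
    (subst (λ W′ → Pruning W′ Gs ρ) (p─x─y≡p─y─x W f x) ρ-pr) T₁-pr T₂-pr ρ⊆T₁ ρ⊆T₂

length≤∣W∣ : Admissible W Gs → length Gs ≤ ∣ W ∣
length≤∣W∣ {W = W} {Gs = Gs} adm with avoiding⇒⊆pruning adm (⊆-min _ , ∅-avoided adm)
  where
  ∅-avoided : ∀ {W Gs} → Admissible W Gs → All (_⊈ ∅) Gs
  ∅-avoided {Gs = []} _ = []
  ∅-avoided {Gs = G ∷ Gs} ((x , x∈G) , _ , adm) = (λ G⊆∅ → ∉⊥ (G⊆∅ x∈G)) ∷ ∅-avoided (adm x∈G)
... | T , T-pr , _ = subst (length Gs ≤_) (∣pruning∣ adm T-pr) (m≤n+m (length Gs) ∣ T ∣)

length≢∣W∣ : Admissible W (G ∷ Gs) → length Gs ≢ ∣ W ∣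
length≢∣W∣ adm r≡∣W∣ = 1+n≰n (subst (_ ≤_) (sym r≡∣W∣) (length≤∣W∣ adm))

module _ {W : Subset n} {Gs : List (Subset n)} (adm : Admissible W Gs) where

  facet⇒pruning : Facet (Avoiding W Gs) T → Pruning W Gs T
  facet⇒pruning (T-face , T-max) with avoiding⇒⊆pruning adm T-face
  ... | T′ , T′-pr , T⊆T′ = subst (Pruning W Gs) (T-max T′ (pruning⇒avoiding T′-pr) T⊆T′) T′-pr

  pruning⇒facet : Pruning W Gs T → Facet (Avoiding W Gs) T
  pruning⇒facet {T = T} T-pr = pruning⇒avoiding T-pr , maximal
    where
    maximal : ∀ τ → Avoiding W Gs τ → T ⊆ τ → τ ≡ T
    maximal τ τ-face T⊆τ with avoiding⇒⊆pruning adm τ-face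
    ... | T′ , T′-pr , τ⊆T′ = ⊆-antisym (⊆-trans τ⊆T′ (⊆-reflexive (sym T≡T′))) T⊆τ
      where
      T≡T′ : T ≡ T′
      T≡T′ = p⊆q∧∣p∣≡∣q∣⇒p≡q (⊆-trans T⊆τ τ⊆T′)
               (+-cancelʳ-≡ (length Gs) ∣ T ∣ ∣ T′ ∣ (trans (∣pruning∣ adm T-pr) (sym (∣pruning∣ adm T′-pr))))

  module _ (k≡ : k + length Gs ≡ ∣ W ∣) where

    ∣pruning∣≡k : Pruning W Gs T → ∣ T ∣ ≡ k
    ∣pruning∣≡k T-pr = +-cancelʳ-≡ (length Gs) _ _ (trans (∣pruning∣ adm T-pr) (sym k≡))

    free-deleted-ridge : x ∈ W ─ ⋃ Gs → Pruning (W - x) Gs ρ →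
                         Ridge k (Avoiding W Gs) ρ × InExactlyOneFacet (Avoiding W Gs) ρ
    free-deleted-ridge {x = f} {ρ = ρ} f∈free ρ-pr with x∈p─q⁻ W (⋃ Gs) f∈free
    ... | f∈W , f∉⋃ with avoiding⇒⊆pruning adm ρ-face
      where
      ρ-face : Avoiding W Gs ρ
      ρ-face = Avoiding-mono (p─q⊆p W ⁅ f ⁆) (pruning⇒avoiding ρ-pr)
    ... | T , T-pr , ρ⊆T =
      (Avoiding-↓ (pruning⇒avoiding T-pr) ρ⊆T , ∣ρ∣+1≡k) , T , pruning⇒facet T-pr , ρ⊆T , unique
      where
      ∣ρ∣+1≡k : ∣ ρ ∣ + 1 ≡ k
      ∣ρ∣+1≡k = +-cancelʳ-≡ (length Gs) _ _ (begin
        ∣ ρ ∣ + 1 + length Gs    ≡⟨ +-assoc ∣ ρ ∣ 1 (length Gs) ⟩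
        ∣ ρ ∣ + suc (length Gs)  ≡⟨ +-suc ∣ ρ ∣ (length Gs) ⟩
        suc (∣ ρ ∣ + length Gs)  ≡⟨ cong suc (∣pruning∣ (admissible-del adm f∉⋃) ρ-pr) ⟩
        suc ∣ W - f ∣            ≡⟨ ∣p-x∣+1≡∣p∣ W f∈W ⟩
        ∣ W ∣                    ≡⟨ sym k≡ ⟩
        k + length Gs            ∎)
        where open ≡-Reasoning
      unique : ∀ T′ → Facet (Avoiding W Gs) T′ → ρ ⊆ T′ → T′ ≡ T
      unique T′ T′-facet ρ⊆T′ = pruning-unique adm f∈W f∉⋃ ρ-pr (facet⇒pruning T′-facet) T-pr ρ⊆T′ ρ⊆T

    -- The facet through a boundary ridge ρ is ρ plus one vertex; if it were a
    -- vertex of some Gᵢ, a second facet would contain ρ.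
    boundary-ridge-misses-free : Ridge k (Avoiding W Gs) ρ → InExactlyOneFacet (Avoiding W Gs) ρ →
                                 W ─ ⋃ Gs ⊈ ρ
    boundary-ridge-misses-free {ρ = ρ} (ρ-face , ∣ρ∣+1≡k) (_ , _ , _ , unique) free⊆ρ
      with avoiding⇒⊆pruning adm ρ-face
    ... | T , T-pr , ρ⊆T with p⊈q⇒∃ T ρ T⊈ρ
      where
      T⊈ρ : T ⊈ ρ
      T⊈ρ T⊆ρ = <⇒≱ (≤-reflexive (trans (+-comm 1 ∣ ρ ∣) (trans ∣ρ∣+1≡k (sym (∣pruning∣≡k T-pr)))))
                    (p⊆q⇒∣p∣≤∣q∣ T⊆ρ)
    ... | y , y∈T , y∉ρ with y ∈? ⋃ Gs
    ...   | no y∉⋃ = y∉ρ (free⊆ρ (x∈p∧x∉q⇒x∈p─q (proj₁ (pruning⇒avoiding T-pr) y∈T) y∉⋃))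
    ...   | yes y∈⋃ with avoiding⇒⊆pruning-∌ adm ρ-face y∉ρ y∈⋃
    ...     | T₂ , T₂-pr , ρ⊆T₂ , y∉T₂ =
      y∉T₂ (subst (y ∈_) (trans (unique T (pruning⇒facet T-pr) ρ⊆T) (sym (unique T₂ (pruning⇒facet T₂-pr) ρ⊆T₂))) y∈T)

    ∂-Avoiding : ∂ k (Avoiding W Gs) ≐ Avoiding W ((W ─ ⋃ Gs) ∷ Gs)
    ∂-Avoiding σ = mk⇔ boundary⇒ boundary⇐
      where
      boundary⇒ : ∂ k (Avoiding W Gs) σ → Avoiding W ((W ─ ⋃ Gs) ∷ Gs) σ
      boundary⇒ (ρ , ρ-ridge , ρ-once , σ⊆ρ) with Avoiding-↓ (proj₁ ρ-ridge) σ⊆ρ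
      ... | σ⊆W , Gs⊈σ = σ⊆W , (λ free⊆σ → boundary-ridge-misses-free ρ-ridge ρ-once (⊆-trans free⊆σ σ⊆ρ)) ∷ Gs⊈σ
      boundary⇐ : Avoiding W ((W ─ ⋃ Gs) ∷ Gs) σ → ∂ k (Avoiding W Gs) σ
      boundary⇐ (σ⊆W , free⊈σ ∷ Gs⊈σ) with p⊈q⇒∃ (W ─ ⋃ Gs) σ free⊈σ
      ... | f , f∈free , f∉σ
          with avoiding⇒⊆pruning (admissible-del adm (proj₂ (x∈p─q⁻ W (⋃ Gs) f∈free)))
                                 (p⊆q∧x∉p⇒p⊆q-x σ⊆W f∉σ , Gs⊈σ)
      ...   | ρ , ρ-pr , σ⊆ρ with free-deleted-ridge f∈free ρ-pr
      ...     | ρ-ridge , ρ-once = ρ , ρ-ridge , ρ-once , σ⊆ρ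

mutual
  Avoiding-SC : ∀ k s (W : Subset n) Gs → Admissible W Gs → k + length Gs ≡ ∣ W ∣ → weight Gs ≤ s →
                SC k (Avoiding W Gs)
  Avoiding-SC k _ W [] _ k≡ _ =
    subst (λ m → SC m (Avoiding W [])) (trans (sym k≡) (+-identityʳ k)) (simplex W Avoiding-[])
  Avoiding-SC k zero W (G ∷ Gs) ((x , x∈G) , _) _ w≤ =
    ⊥-elim (n≮0 (<-≤-trans (x∈p⇒∣p-x∣<∣p∣ x∈G) (m+n≤o⇒m≤o ∣ G ∣ w≤)))
  Avoiding-SC k (suc s) W (G ∷ Gs) ((x , x∈G) , G⊆W , adm) k≡ w≤ with nonempty? (G - x)
  ... | no G-x-empty =
    SC-resp (≐-sym (≐-trans (Avoiding-split x∈G) (∪ᶜ-voidʳ (Avoiding-void G-x-empty))))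
      (Avoiding-SC k s (W - x) Gs (adm x∈G) (1+k≡∣p∣⇒k≡∣p-x∣ (G⊆W x∈G) (trans (sym (+-suc k _)) k≡)) (∣p∣+m≤1+k⇒m≤k x∈G w≤))
  Avoiding-SC zero (suc s) W (G ∷ Gs) adm@((x , x∈G) , G⊆W , _) k≡ w≤ | yes G-x≢∅ =
    ⊥-elim (length≢∣W∣ (admissible-meet adm x∈G G-x≢∅) (1+k≡∣p∣⇒k≡∣p-x∣ (G⊆W x∈G) k≡))
  Avoiding-SC (suc k) (suc s) W (G ∷ Gs) adm@((x , x∈G) , G⊆W , adm-x) k≡ w≤ | yes G-x≢∅ =
    glue (Avoiding-split x∈G) Avoiding-meet
      (Avoiding-SC (suc k) s (W - x) Gs (adm-x x∈G) (1+k≡∣p∣⇒k≡∣p-x∣ (G⊆W x∈G) (trans (sym (+-suc (suc k) _)) k≡))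
        (∣p∣+m≤1+k⇒m≤k x∈G w≤))
      (Avoiding-SC (suc k) s W ((G - x) ∷ Gs) (admissible-shrink adm x∈G G-x≢∅) k≡ (∣p∣+m≤1+k⇒∣p-x∣+m≤k x∈G w≤))
      (Avoiding-SC k _ (W - x) ((G - x) ∷ Gs) adm-meet (1+k≡∣p∣⇒k≡∣p-x∣ (G⊆W x∈G) k≡) ≤-refl)
      (boundary-condition k (W - x) ((G - x) ∷ Gs) adm-meet (1+k≡∣p∣⇒k≡∣p-x∣ (G⊆W x∈G) k≡))
    where
    adm-meet : Admissible (W - x) ((G - x) ∷ Gs)
    adm-meet = admissible-meet adm x∈G G-x≢∅

  boundary-condition : ∀ k (W : Subset n) Gs → Admissible W Gs → k + length Gs ≡ ∣ W ∣ →
                       BoundaryCondition k (Avoiding W Gs)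
  boundary-condition k W Gs adm k≡ with nonempty? (W ─ ⋃ Gs)
  ... | no free-empty = inj₁ λ σ → Avoiding-void free-empty σ ∘ to (∂-Avoiding adm k≡ σ)
  boundary-condition zero W Gs adm k≡ | yes free≢∅ = ⊥-elim (length≢∣W∣ (admissible-free adm free≢∅) k≡)
  boundary-condition (suc j) W Gs adm k≡ | yes free≢∅ =
    inj₂ (SC-resp (≐-sym (∂-Avoiding adm k≡))
           (Avoiding-SC j _ W ((W ─ ⋃ Gs) ∷ Gs) (admissible-free adm free≢∅) (trans (+-suc j _) k≡) ≤-refl))

stellar-simplex≐Avoiding : ∀ {S F : Subset n} → F ⊆ S →
                           Stellar (Simplex S) F ≐ Avoiding (inside ∷ S) ((outside ∷ F) ∷ [])
stellar-simplex≐Avoiding F⊆S (outside ∷ H) =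
  mk⇔ (λ { (H⊆S , F⊈H) → out⊆ H⊆S , (λ F⊆H → F⊈H (drop-∷-⊆ F⊆H)) ∷ [] })
      (λ { (H⊆S , F⊈H ∷ []) → drop-∷-⊆ H⊆S , λ F⊆H → F⊈H (s⊆s F⊆H) })
stellar-simplex≐Avoiding F⊆S (inside ∷ H) =
  mk⇔ (λ { (H⊆S , F⊈H , _) → in⊆in H⊆S , (λ F⊆H → F⊈H (drop-∷-⊆ F⊆H)) ∷ [] })
      (λ { (H⊆S , F⊈H ∷ []) → drop-∷-⊆ H⊆S , (λ F⊆H → F⊈H (out⊆ F⊆H)) , ∪-least (drop-∷-⊆ H⊆S) F⊆S })

lemma10 : (n : ℕ) (S F : Subset n) → F ⊆ S → Nonempty F →
    SC ∣ S ∣ (Stellar (Simplex S) F)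
lemma10 n S F F⊆S (x , x∈F) =
  SC-resp (≐-sym (stellar-simplex≐Avoiding F⊆S))
    (Avoiding-SC ∣ S ∣ _ (inside ∷ S) ((outside ∷ F) ∷ []) F-admissible (+-comm ∣ S ∣ 1) ≤-refl)
  where
  F-admissible : Admissible (inside ∷ S) ((outside ∷ F) ∷ [])
  F-admissible = (suc x , there x∈F) , out⊆ F⊆S , λ _ → tt
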